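{- Let $G$ be a finite group whose commutator subgroup $G'$ is cyclic and such that $G/G' \cong \mathbb{Z}_2 \times \mathbb{Z}_2$. If $S$ is any $2$-element generating set of $G$, then $\mathrm{Cay}(G;S)$ has a hamiltonian cycle.
   Context: $G' = \langle [g,h] : g,h \in G\rangle$ with $[g,h] = g^{ -1}h^{ -1}gh$. For a subset $S\subseteq G$, $\mathrm{Cay}(G;S)$ is the graph with vertex set $G$ in which $g$ and $h$ are adjacent iff $h = gs$ for some $s \in S\cup S^{ -1}$. A hamiltonian cycle is a cycle through every vertex exactly once. -}

module Defs where

open import Level using (Level; _⊔_)
open import Algebra.Bundles using (Group)
open import Data.Nat using (ℕ; zero; suc; _≤_)
open import Data.Integer using (ℤ; +_; -[1+_])
open import Data.Fin using (Fin; inject₁; fromℕ)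
open import Data.Bool using (Bool; true; false; _xor_)
open import Data.Product using (Σ; _×_; _,_; ∃; ∃-syntax)
open import Data.Sum using (_⊎_)
open import Relation.Binary.PropositionalEquality using (_≡_)
open import Relation.Nullary using (¬_)

V₄ : Set
V₄ = Bool × Bool

_⊕_ : V₄ → V₄ → V₄
(a , b) ⊕ (c , d) = (a xor c) , (b xor d)

e₄ : V₄
e₄ = false , false

module _ {c ℓ : Level} (G : Group c ℓ) where
  open Group G

  powℕ : Carrier → ℕ → Carrier
  powℕ x zero = ε
  powℕ x (suc n) = x ∙ powℕ x n

  powℤ : Carrier → ℤ → Carrier
  powℤ x (+ n) = powℕ x n
  powℤ x -[1+ n ] = (powℕ x (suc n)) ⁻¹

  commutator : Carrier → Carrier → Carrier
  commutator g h = ((g ⁻¹ ∙ h ⁻¹) ∙ g) ∙ h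

  IsCommutator : Carrier → Set (c ⊔ ℓ)
  IsCommutator x = ∃[ g ] ∃[ h ] (x ≈ commutator g h)

  data InGen {p : Level} (P : Carrier → Set p) : Carrier → Set (c ⊔ ℓ ⊔ p) where
    gen  : ∀ {x} → P x → InGen P x
    unit : InGen P ε
    mul  : ∀ {x y} → InGen P x → InGen P y → InGen P (x ∙ y)
    inv  : ∀ {x} → InGen P x → InGen P (x ⁻¹)
    resp : ∀ {x y} → x ≈ y → InGen P x → InGen P y

  InDerived : Carrier → Set (c ⊔ ℓ)
  InDerived = InGen IsCommutator

  DerivedCyclic : Set (c ⊔ ℓ)
  DerivedCyclic = ∃[ z ] (InDerived z × (∀ x → InDerived x → ∃[ k ] (x ≈ powℤ z k)))

  -- G / G' ≅ ℤ₂ × ℤ₂, expressed via a surjective homomorphism G → ℤ₂ × ℤ₂ with kernel G'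
  -- (first isomorphism theorem; quotient types are unavailable)
  AbelianizationKlein : Set (c ⊔ ℓ)
  AbelianizationKlein =
    Σ (Carrier → V₄) λ φ →
      (∀ x y → x ≈ y → φ x ≡ φ y) ×
      (∀ x y → φ (x ∙ y) ≡ φ x ⊕ φ y) ×
      (∀ v → ∃[ x ] (φ x ≡ v)) ×
      (∀ x → φ x ≡ e₄ → InDerived x) ×
      (∀ x → InDerived x → φ x ≡ e₄)

  IsFinite : Set (c ⊔ ℓ)
  IsFinite = ∃[ n ] Σ (Fin n → Carrier) λ f →
    (∀ i j → f i ≈ f j → i ≡ j) × (∀ x → ∃[ i ] (f i ≈ x))

  CayAdj : {p : Level} → (Carrier → Set p) → Carrier → Carrier → Set (c ⊔ ℓ ⊔ p)
  CayAdj S g h = ∃[ s ] ((S s ⊎ S (s ⁻¹)) × (h ≈ g ∙ s))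

  -- Cay(G;S) has a hamiltonian cycle: a cyclic listing v₀,…,v_m of all vertices, each
  -- exactly once (m+1 ≥ 3 vertices), with consecutive ones (and v_m, v₀) adjacent.
  CayHamiltonian : {p : Level} → (Carrier → Set p) → Set (c ⊔ ℓ ⊔ p)
  CayHamiltonian S = ∃[ m ] Σ (Fin (suc m) → Carrier) λ v →
    (2 ≤ m) ×
    (∀ i j → v i ≈ v j → i ≡ j) ×
    (∀ x → ∃[ i ] (v i ≈ x)) ×
    (∀ (i : Fin m) → CayAdj S (v (inject₁ i)) (v (Fin.suc i))) ×
    CayAdj S (v (fromℕ m)) (v Fin.zero)

  Pair : Carrier → Carrier → Carrier → Set ℓ
  Pair a b x = (x ≈ a) ⊎ (x ≈ b)

  Generates : {p : Level} → (Carrier → Set p) → Set (c ⊔ ℓ ⊔ p)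
  Generates S = ∀ x → InGen S x

{-# OPTIONS --safe #-}
-- Let γ = [a, b].  As G' is cyclic, ⟨γ⟩ ⊆ G' is normal in G, and modulo ⟨γ⟩ the generators
-- a and b commute; hence G' = ⟨γ⟩.  The images of a and b span G/G' ≅ ℤ₂ × ℤ₂, so the
-- prefixes ε, a⁻¹, a⁻¹b⁻¹, a⁻¹b⁻¹a of the word a⁻¹b⁻¹ab represent the four cosets of G'.
-- Every lap of the walk (a⁻¹, b⁻¹, a, b) multiplies the position by γ on the left, so if γ
-- has order n, then n laps from ε visit each γ^q p (q < n, p a prefix), i.e. each element of
-- G, exactly once and return to ε.
module Submission where

open import Defs
open import Level using (Level; _⊔_)
open import Algebra.Bundles using (Group)
open import Data.Bool using (Bool; true; false)
open import Data.Bool.Properties using () renaming (_≟_ to _≟ᵇ_)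
open import Data.Empty using (⊥-elim)
open import Data.Fin as Fin using (Fin; toℕ; fromℕ; fromℕ<; inject₁; _≟_)
open import Data.Fin.Properties
  using (all?; any?; pigeonhole; ¬∀⟶∃¬-smallest;
         toℕ-injective; toℕ<n; toℕ-fromℕ; toℕ-fromℕ<; toℕ-inject; toℕ-inject₁)
open import Data.Integer using (+_; -[1+_])
open import Data.Nat using (ℕ; zero; suc; _+_; _*_; _<_; _%_; _/_; s≤s; z≤n; NonZero)
open import Data.Nat.DivMod using (m≡m%n+[m/n]*n; m%n<n; _divMod_; result)
open import Data.Nat.Properties
  using (+-comm; +-suc; *-comm; <-cmp; n<1+n; m≤m+n; m≤n+m; ≤-trans; ≤-<-trans; ≤-reflexive;
         +-monoʳ-<; *-monoˡ-≤; *-cancelʳ-<; m≤n⇒∃[o]m+o≡n)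
open import Data.Product using (∃; ∃₂; _×_; _,_; proj₁; proj₂)
open import Data.Product.Properties using (≡-dec)
open import Data.Sum using (_⊎_; inj₁; inj₂)
open import Relation.Binary using (tri<; tri≈; tri>)
open import Relation.Binary.PropositionalEquality as ≡ using (_≡_; cong; cong₂; subst)
open import Relation.Nullary using (Dec; ¬_)
open import Relation.Nullary.Decidable using (from-yes; map′; ¬?; _×-dec_; _→-dec_; decidable-stable)
open import Relation.Unary using (Pred; Decidable)

private
  variable
    p : Level

-- ℤ₂ × ℤ₂ is finite, so its identities are decided by evaluation.

infix 4 _≟₄_

_≟₄_ : (u v : V₄) → Dec (u ≡ v)
_≟₄_ = ≡-dec _≟ᵇ_ _≟ᵇ_

all-Bool? : {P : Pred Bool p} → Decidable P → Dec (∀ x → P x)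
all-Bool? P? = map′ (λ (f , t) → λ { false → f ; true → t }) (λ h → h false , h true) (P? false ×-dec P? true)

all₄? : {P : Pred V₄ p} → Decidable P → Dec (∀ u → P u)
all₄? P? = map′ (λ h (x , y) → h x y) (λ h x y → h (x , y)) (all-Bool? λ x → all-Bool? λ y → P? (x , y))

⊕-self : ∀ u → u ⊕ u ≡ e₄
⊕-self = from-yes (all₄? λ u → u ⊕ u ≟₄ e₄)

⊕≡e₄⇒≡ : ∀ u v → u ⊕ v ≡ e₄ → u ≡ v
⊕≡e₄⇒≡ = from-yes (all₄? λ u → all₄? λ v → (u ⊕ v ≟₄ e₄) →-dec (u ≟₄ v))

[u⊕v]⊕u≡v : ∀ u v → (u ⊕ v) ⊕ u ≡ v
[u⊕v]⊕u≡v = from-yes (all₄? λ u → all₄? λ v → (u ⊕ v) ⊕ u ≟₄ v)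

-- {0, A, A ⊕ B, B}, in the order in which the walk meets the cosets of G'.
span₄ : V₄ → V₄ → Fin 4 → V₄
span₄ A B Fin.zero = e₄
span₄ A B (Fin.suc Fin.zero) = A
span₄ A B (Fin.suc (Fin.suc Fin.zero)) = A ⊕ B
span₄ A B (Fin.suc (Fin.suc (Fin.suc Fin.zero))) = B

span₄-closed : ∀ A B r s → ∃ λ t → span₄ A B r ⊕ span₄ A B s ≡ span₄ A B t
span₄-closed = from-yes (all₄? λ A → all₄? λ B → all? λ r → all? λ s →
  any? λ t → span₄ A B r ⊕ span₄ A B s ≟₄ span₄ A B t)

span₄-surjective⇒injective : ∀ A B → (∀ w → ∃ λ r → span₄ A B r ≡ w) →
                             ∀ r s → span₄ A B r ≡ span₄ A B s → r ≡ s
span₄-surjective⇒injective = from-yes (all₄? λ A → all₄? λ B →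
  (all₄? λ w → any? λ r → span₄ A B r ≟₄ w) →-dec
  (all? λ r → all? λ s → (span₄ A B r ≟₄ span₄ A B s) →-dec (r ≟ s)))

module GroupWords {c ℓ : Level} (G : Group c ℓ) where
  open Group G
  open import Algebra.Properties.Group G using (ε⁻¹≈ε; ⁻¹-involutive; ⁻¹-anti-homo-∙)
  open import Data.Bool using (_∧_; _xor_; not; if_then_else_)
  open import Data.List using (List; []; _∷_)
  open import Relation.Nullary using (does; yes; no)
  open import Relation.Binary.Reasoning.Setoid setoid

  infixl 7 _·_
  infix 8 _⁻

  data Expr (n : ℕ) : Set where
    var : Fin n → Expr n
    𝟙   : Expr n
    _·_ : Expr n → Expr n → Expr n
    _⁻  : Expr n → Expr n

  X : ∀ {n} → Expr (suc n)
  X = var Fin.zero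

  Y : ∀ {n} → Expr (suc (suc n))
  Y = var (Fin.suc Fin.zero)

  Z : ∀ {n} → Expr (suc (suc (suc n)))
  Z = var (Fin.suc (Fin.suc Fin.zero))

  Letter : ℕ → Set
  Letter n = Fin n × Bool

  Word : ℕ → Set
  Word n = List (Letter n)

  module _ {n : ℕ} where
    cancels : Letter n → Letter n → Bool
    cancels (i , s) (j , t) = does (i ≟ j) ∧ (s xor t)

    _◁_ : Letter n → Word n → Word n
    l ◁ [] = l ∷ []
    l ◁ (l′ ∷ w) = if cancels l l′ then w else l ∷ l′ ∷ w

    _⊙_ : Word n → Word n → Word n
    [] ⊙ w = w
    (l ∷ u) ⊙ w = l ◁ (u ⊙ w)

    invert : Word n → Word n
    invert [] = []
    invert ((i , s) ∷ w) = invert w ⊙ ((i , not s) ∷ [])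

    normalise : Expr n → Word n
    normalise (var i) = (i , false) ∷ []
    normalise 𝟙 = []
    normalise (x · y) = normalise x ⊙ normalise y
    normalise (x ⁻) = invert (normalise x)

  module _ {n : ℕ} (ρ : Fin n → Carrier) where
    ⟦_⟧ : Expr n → Carrier
    ⟦ var i ⟧ = ρ i
    ⟦ 𝟙 ⟧ = ε
    ⟦ x · y ⟧ = ⟦ x ⟧ ∙ ⟦ y ⟧
    ⟦ x ⁻ ⟧ = ⟦ x ⟧ ⁻¹

    ⟦_⟧ₗ : Letter n → Carrier
    ⟦ i , false ⟧ₗ = ρ i
    ⟦ i , true ⟧ₗ = ρ i ⁻¹

    ⟦_⟧w : Word n → Carrier
    ⟦ [] ⟧w = ε
    ⟦ l ∷ w ⟧w = ⟦ l ⟧ₗ ∙ ⟦ w ⟧w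

    cancels-sound : ∀ l l′ → cancels l l′ ≡ true → ⟦ l ⟧ₗ ∙ ⟦ l′ ⟧ₗ ≈ ε
    cancels-sound (i , s) (j , t) eq with i ≟ j
    cancels-sound (i , false) (.i , true) eq | yes ≡.refl = inverseʳ (ρ i)
    cancels-sound (i , true) (.i , false) eq | yes ≡.refl = inverseˡ (ρ i)
    cancels-sound (i , false) (.i , false) () | yes ≡.refl
    cancels-sound (i , true) (.i , true) () | yes ≡.refl
    cancels-sound (i , s) (j , t) () | no _

    ◁-sound : ∀ l w → ⟦ l ◁ w ⟧w ≈ ⟦ l ⟧ₗ ∙ ⟦ w ⟧w
    ◁-sound l [] = refl
    ◁-sound l (l′ ∷ w) with cancels l l′ in eq
    ... | false = refl
    ... | true = begin
      ⟦ w ⟧w                         ≈⟨ identityˡ _ ⟨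
      ε ∙ ⟦ w ⟧w                     ≈⟨ ∙-congʳ (cancels-sound l l′ eq) ⟨
      (⟦ l ⟧ₗ ∙ ⟦ l′ ⟧ₗ) ∙ ⟦ w ⟧w     ≈⟨ assoc _ _ _ ⟩
      ⟦ l ⟧ₗ ∙ (⟦ l′ ⟧ₗ ∙ ⟦ w ⟧w)     ∎

    ⊙-sound : ∀ u w → ⟦ u ⊙ w ⟧w ≈ ⟦ u ⟧w ∙ ⟦ w ⟧w
    ⊙-sound [] w = sym (identityˡ _)
    ⊙-sound (l ∷ u) w = begin
      ⟦ l ◁ (u ⊙ w) ⟧w          ≈⟨ ◁-sound l (u ⊙ w) ⟩
      ⟦ l ⟧ₗ ∙ ⟦ u ⊙ w ⟧w       ≈⟨ ∙-congˡ (⊙-sound u w) ⟩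
      ⟦ l ⟧ₗ ∙ (⟦ u ⟧w ∙ ⟦ w ⟧w) ≈⟨ assoc _ _ _ ⟨
      (⟦ l ⟧ₗ ∙ ⟦ u ⟧w) ∙ ⟦ w ⟧w ∎

    invert-letter : ∀ i s → ⟦ i , not s ⟧ₗ ≈ ⟦ i , s ⟧ₗ ⁻¹
    invert-letter i false = refl
    invert-letter i true = sym (⁻¹-involutive (ρ i))

    invert-sound : ∀ w → ⟦ invert w ⟧w ≈ ⟦ w ⟧w ⁻¹
    invert-sound [] = sym ε⁻¹≈ε
    invert-sound ((i , s) ∷ w) = begin
      ⟦ invert w ⊙ ((i , not s) ∷ []) ⟧w      ≈⟨ ⊙-sound (invert w) _ ⟩
      ⟦ invert w ⟧w ∙ (⟦ i , not s ⟧ₗ ∙ ε)    ≈⟨ ∙-cong (invert-sound w) (identityʳ _) ⟩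
      ⟦ w ⟧w ⁻¹ ∙ ⟦ i , not s ⟧ₗ              ≈⟨ ∙-congˡ (invert-letter i s) ⟩
      ⟦ w ⟧w ⁻¹ ∙ ⟦ i , s ⟧ₗ ⁻¹               ≈⟨ ⁻¹-anti-homo-∙ _ _ ⟨
      (⟦ i , s ⟧ₗ ∙ ⟦ w ⟧w) ⁻¹                ∎

    normalise-sound : ∀ e → ⟦ normalise e ⟧w ≈ ⟦ e ⟧
    normalise-sound (var i) = identityʳ _
    normalise-sound 𝟙 = refl
    normalise-sound (x · y) =
      trans (⊙-sound (normalise x) (normalise y)) (∙-cong (normalise-sound x) (normalise-sound y))
    normalise-sound (x ⁻) = trans (invert-sound (normalise x)) (⁻¹-cong (normalise-sound x))

    prove : ∀ e₁ e₂ → normalise e₁ ≡ normalise e₂ → ⟦ e₁ ⟧ ≈ ⟦ e₂ ⟧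
    prove e₁ e₂ eq = begin
      ⟦ e₁ ⟧               ≈⟨ normalise-sound e₁ ⟨
      ⟦ normalise e₁ ⟧w    ≡⟨ cong ⟦_⟧w eq ⟩
      ⟦ normalise e₂ ⟧w    ≈⟨ normalise-sound e₂ ⟩
      ⟦ e₂ ⟧               ∎

module GroupTheory {c ℓ : Level} (G : Group c ℓ) where
  open Group G
  open import Algebra.Properties.Group G using (inverseʳ-unique; ∙-cancelˡ)
  open import Data.Vec.Functional using ([]; _∷_)
  open import Relation.Binary.Reasoning.Setoid setoid
  open GroupWords G

  conj : Carrier → Carrier → Carrier
  conj g x = (g ⁻¹ ∙ x) ∙ g

  [_,_] : Carrier → Carrier → Carrier
  [ u , v ] = commutator G u v

  conj-cong : ∀ g {x y} → x ≈ y → conj g x ≈ conj g y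
  conj-cong g x≈y = ∙-congʳ (∙-congˡ x≈y)

  conj-ε : ∀ g → conj g ε ≈ ε
  conj-ε g = prove (g ∷ []) ((X ⁻ · 𝟙) · X) 𝟙 ≡.refl

  conj-∙ : ∀ g x y → conj g (x ∙ y) ≈ conj g x ∙ conj g y
  conj-∙ g x y = prove (g ∷ x ∷ y ∷ [])
    ((X ⁻ · (Y · Z)) · X) (((X ⁻ · Y) · X) · ((X ⁻ · Z) · X)) ≡.refl

  conj-⁻¹ : ∀ g x → conj g (x ⁻¹) ≈ conj g x ⁻¹
  conj-⁻¹ g x = prove (g ∷ x ∷ []) ((X ⁻ · Y ⁻) · X) (((X ⁻ · Y) · X) ⁻) ≡.refl

  conj-commutator : ∀ g u v → conj g [ u , v ] ≈ [ conj g u , conj g v ]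
  conj-commutator g u v = prove (g ∷ u ∷ v ∷ [])
    ((X ⁻ · (((Y ⁻ · Z ⁻) · Y) · Z)) · X)
    (((((X ⁻ · Y) · X) ⁻ · ((X ⁻ · Z) · X) ⁻) · ((X ⁻ · Y) · X)) · ((X ⁻ · Z) · X)) ≡.refl

  commutator-congʳ : ∀ u {v w} → v ≈ w → [ u , v ] ≈ [ u , w ]
  commutator-congʳ u v≈w = ∙-cong (∙-congʳ (∙-congˡ (⁻¹-cong v≈w))) v≈w

  commutator-self : ∀ u → [ u , u ] ≈ ε
  commutator-self u = prove (u ∷ []) (((X ⁻ · X ⁻) · X) · X) 𝟙 ≡.refl

  commutator-ε : ∀ u → [ u , ε ] ≈ ε
  commutator-ε u = prove (u ∷ []) (((X ⁻ · 𝟙 ⁻) · X) · 𝟙) 𝟙 ≡.refl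

  commutator-⁻¹ : ∀ u v → [ u , v ] ⁻¹ ≈ [ v , u ]
  commutator-⁻¹ u v = prove (u ∷ v ∷ []) ((((X ⁻ · Y ⁻) · X) · Y) ⁻) (((Y ⁻ · X ⁻) · Y) · X) ≡.refl

  commutator-∙ʳ : ∀ u v w → [ u , v ∙ w ] ≈ [ u , w ] ∙ conj w [ u , v ]
  commutator-∙ʳ u v w = prove (u ∷ v ∷ w ∷ [])
    (((X ⁻ · (Y · Z) ⁻) · X) · (Y · Z))
    ((((X ⁻ · Z ⁻) · X) · Z) · ((Z ⁻ · (((X ⁻ · Y ⁻) · X) · Y)) · Z)) ≡.refl

  commutator-⁻¹ʳ : ∀ u v → [ u , v ⁻¹ ] ≈ conj (v ⁻¹) ([ u , v ] ⁻¹)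
  commutator-⁻¹ʳ u v = prove (u ∷ v ∷ [])
    (((X ⁻ · Y ⁻ ⁻) · X) · Y ⁻)
    ((Y ⁻ ⁻ · (((X ⁻ · Y ⁻) · X) · Y) ⁻) · Y ⁻) ≡.refl

  derived-conj : ∀ g {x} → InDerived G x → InDerived G (conj g x)
  derived-conj g (gen (u , v , x≈[u,v])) =
    resp (sym (trans (conj-cong g x≈[u,v]) (conj-commutator g u v))) (gen (_ , _ , refl))
  derived-conj g unit = resp (sym (conj-ε g)) unit
  derived-conj g (mul x∈G′ y∈G′) =
    resp (sym (conj-∙ g _ _)) (mul (derived-conj g x∈G′) (derived-conj g y∈G′))
  derived-conj g (inv x∈G′) = resp (sym (conj-⁻¹ g _)) (inv (derived-conj g x∈G′))
  derived-conj g (resp x≈y x∈G′) = resp (conj-cong g x≈y) (derived-conj g x∈G′)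

  infixr 8 _^_

  _^_ : Carrier → ℕ → Carrier
  x ^ n = powℕ G x n

  ^-cong : ∀ n {x y} → x ≈ y → x ^ n ≈ y ^ n
  ^-cong zero x≈y = refl
  ^-cong (suc n) x≈y = ∙-cong x≈y (^-cong n x≈y)

  ^-+ : ∀ x m n → x ^ (m + n) ≈ x ^ m ∙ x ^ n
  ^-+ x zero n = sym (identityˡ _)
  ^-+ x (suc m) n = trans (∙-congˡ (^-+ x m n)) (sym (assoc _ _ _))

  ^-* : ∀ x m n → x ^ (m * n) ≈ (x ^ n) ^ m
  ^-* x zero n = refl
  ^-* x (suc m) n = trans (^-+ x n (m * n)) (∙-congˡ (^-* x m n))

  ^-comm : ∀ x m n → (x ^ m) ^ n ≈ (x ^ n) ^ m
  ^-comm x m n = begin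
    (x ^ m) ^ n    ≈⟨ ^-* x n m ⟨
    x ^ (n * m)    ≡⟨ cong (x ^_) (*-comm n m) ⟩
    x ^ (m * n)    ≈⟨ ^-* x m n ⟩
    (x ^ n) ^ m    ∎

  ε^ : ∀ n → ε ^ n ≈ ε
  ε^ zero = refl
  ε^ (suc n) = trans (identityˡ _) (ε^ n)

  conj-^ : ∀ g x n → conj g (x ^ n) ≈ conj g x ^ n
  conj-^ g x zero = conj-ε g
  conj-^ g x (suc n) = trans (conj-∙ g x (x ^ n)) (∙-congˡ (conj-^ g x n))

  ^-inverse : ∀ {x} M → x ^ suc M ≈ ε → ∀ i → (x ^ i) ⁻¹ ≈ x ^ (M * i)
  ^-inverse {x} M x^[1+M]≈ε i = sym (inverseʳ-unique (x ^ i) (x ^ (M * i)) (begin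
    x ^ i ∙ x ^ (M * i)    ≈⟨ ^-+ x i (M * i) ⟨
    x ^ (suc M * i)        ≈⟨ ^-* x (suc M) i ⟩
    (x ^ i) ^ suc M        ≈⟨ ^-comm x i (suc M) ⟩
    (x ^ suc M) ^ i        ≈⟨ ^-cong i x^[1+M]≈ε ⟩
    ε ^ i                  ≈⟨ ε^ i ⟩
    ε                      ∎))

  ^-cancel : ∀ x i d → x ^ i ≈ x ^ (i + d) → x ^ d ≈ ε
  ^-cancel x i d x^i≈x^[i+d] = ∙-cancelˡ (x ^ i) (x ^ d) ε (begin
    x ^ i ∙ x ^ d    ≈⟨ ^-+ x i d ⟨
    x ^ (i + d)      ≈⟨ x^i≈x^[i+d] ⟨
    x ^ i            ≈⟨ identityʳ _ ⟨
    x ^ i ∙ ε        ∎)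

  ^-mod : ∀ {x n} .{{_ : NonZero n}} → x ^ n ≈ ε → ∀ k → x ^ k ≈ x ^ (k % n)
  ^-mod {x} {n} x^n≈ε k = begin
    x ^ k                                ≡⟨ cong (x ^_) (m≡m%n+[m/n]*n k n) ⟩
    x ^ (k % n + (k / n) * n)            ≈⟨ ^-+ x (k % n) _ ⟩
    x ^ (k % n) ∙ x ^ ((k / n) * n)      ≈⟨ ∙-congˡ (^-* x (k / n) n) ⟩
    x ^ (k % n) ∙ (x ^ n) ^ (k / n)      ≈⟨ ∙-congˡ (^-cong (k / n) x^n≈ε) ⟩
    x ^ (k % n) ∙ ε ^ (k / n)            ≈⟨ ∙-congˡ (ε^ (k / n)) ⟩
    x ^ (k % n) ∙ ε                      ≈⟨ identityʳ _ ⟩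
    x ^ (k % n)                          ∎

  powℤ-as-powℕ : ∀ {x} M → x ^ suc M ≈ ε → ∀ k → ∃ λ s → powℤ G x k ≈ x ^ s
  powℤ-as-powℕ M x^[1+M]≈ε (+ s) = s , refl
  powℤ-as-powℕ M x^[1+M]≈ε -[1+ t ] = M * suc t , ^-inverse M x^[1+M]≈ε (suc t)

  IsOrder : Carrier → ℕ → Set ℓ
  IsOrder x n = 0 < n × x ^ n ≈ ε × (∀ d → 0 < d → d < n → x ^ d ≉ ε)

  <⇒+suc≡ : ∀ {i j} → i < j → ∃ λ d → i + suc d ≡ j
  <⇒+suc≡ {i} i<j = let d , 1+i+d≡j = m≤n⇒∃[o]m+o≡n i<j in d , ≡.trans (+-suc i d) 1+i+d≡j

  ^-distinct-below-order : ∀ {x n i j} → IsOrder x n → i < j → j < n → x ^ i ≉ x ^ j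
  ^-distinct-below-order {x} {n} {i} (_ , _ , minimal) i<j j<n x^i≈x^j =
    let d , i+[1+d]≡j = <⇒+suc≡ i<j
    in minimal (suc d) (s≤s z≤n) (≤-<-trans (m≤n+m (suc d) i) (subst (_< n) (≡.sym i+[1+d]≡j) j<n))
               (^-cancel x i (suc d) (trans x^i≈x^j (reflexive (cong (x ^_) (≡.sym i+[1+d]≡j)))))

  ^-injective : ∀ {x n i j} → IsOrder x n → i < n → j < n → x ^ i ≈ x ^ j → i ≡ j
  ^-injective {i = i} {j} x-order i<n j<n x^i≈x^j with <-cmp i j
  ... | tri< i<j _ _ = ⊥-elim (^-distinct-below-order x-order i<j j<n x^i≈x^j)
  ... | tri≈ _ i≡j _ = i≡j
  ... | tri> _ _ j<i = ⊥-elim (^-distinct-below-order x-order j<i i<n (sym x^i≈x^j))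

  order-exists : (∀ x y → Dec (x ≈ y)) → ∀ {x} M → x ^ suc M ≈ ε → ∃ λ n₀ → IsOrder x (suc n₀)
  order-exists ≈-dec {x} M x^[1+M]≈ε =
    let i , x^[1+i]≈ε , below-i =
          ¬∀⟶∃¬-smallest (suc M) Aperiodic (λ i → ¬? (≈-dec (x ^ suc (toℕ i)) ε)) not-aperiodic
    in toℕ i , s≤s z≤n , decidable-stable (≈-dec _ ε) x^[1+i]≈ε , minimal below-i
    where
    Aperiodic : Fin (suc M) → Set ℓ
    Aperiodic i = x ^ suc (toℕ i) ≉ ε

    not-aperiodic : ¬ (∀ i → Aperiodic i)
    not-aperiodic aperiodic =
      aperiodic (fromℕ M) (subst (λ k → x ^ suc k ≈ ε) (≡.sym (toℕ-fromℕ M)) x^[1+M]≈ε)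

    minimal : ∀ {i} → (∀ (j : Fin (toℕ i)) → Aperiodic (Fin.inject j)) →
              ∀ d → 0 < d → d < suc (toℕ i) → x ^ d ≉ ε
    minimal below-i (suc k) _ (s≤s k<i) =
      let j = fromℕ< k<i
      in subst (λ t → x ^ suc t ≉ ε) (≡.trans (toℕ-inject j) (toℕ-fromℕ< k<i)) (below-i j)

  finite⇒decidable : IsFinite G → ∀ x y → Dec (x ≈ y)
  finite⇒decidable (_ , f , f-injective , f-surjective) x y =
    let i , fi≈x = f-surjective x
        j , fj≈y = f-surjective y
    in map′ (λ i≡j → trans (sym fi≈x) (trans (reflexive (cong f i≡j)) fj≈y))
            (λ x≈y → f-injective i j (trans fi≈x (trans x≈y (sym fj≈y))))
            (i ≟ j)

  finite⇒torsion : IsFinite G → ∀ x → ∃ λ M → x ^ suc M ≈ ε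
  finite⇒torsion (N , f , _ , f-surjective) x =
    let i , j , i<j , same-index = pigeonhole (n<1+n N) (λ k → proj₁ (f-surjective (x ^ toℕ k)))
        d , i+[1+d]≡j = <⇒+suc≡ i<j
        x^i≈x^j = trans (sym (proj₂ (f-surjective _))) (trans (reflexive (cong f same-index)) (proj₂ (f-surjective _)))
    in d , ^-cancel x (toℕ i) (suc d) (trans x^i≈x^j (reflexive (cong (x ^_) (≡.sym i+[1+d]≡j))))

  derived-conj-power : (∀ x → ∃ λ M → x ^ suc M ≈ ε) → DerivedCyclic G →
                       ∀ {x} → InDerived G x → ∀ g → ∃ λ r → conj g x ≈ x ^ r
  derived-conj-power torsion (z , z∈G′ , cyclic) {x} x∈G′ g =
    let s , x≈z^s = power-of-z x∈G′
        r , gz≈z^r = power-of-z (derived-conj g z∈G′)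
    in r , (begin
      conj g x          ≈⟨ conj-cong g x≈z^s ⟩
      conj g (z ^ s)    ≈⟨ conj-^ g z s ⟩
      conj g z ^ s      ≈⟨ ^-cong s gz≈z^r ⟩
      (z ^ r) ^ s       ≈⟨ ^-comm z r s ⟩
      (z ^ s) ^ r       ≈⟨ ^-cong r x≈z^s ⟨
      x ^ r             ∎)
    where
    power-of-z : ∀ {y} → InDerived G y → ∃ λ s → y ≈ z ^ s
    power-of-z y∈G′ =
      let k , y≈z^k = cyclic _ y∈G′
          s , z^k≈z^s = powℤ-as-powℕ (proj₁ (torsion z)) (proj₂ (torsion z)) k
      in s , trans y≈z^k z^k≈z^s

  record IsNormalSubgroup {k : Level} (K : Carrier → Set k) : Set (c ⊔ ℓ ⊔ k) where
    field
      ∈-resp : ∀ {x y} → x ≈ y → K x → K y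
      ε-∈    : K ε
      ∙-∈    : ∀ {x y} → K x → K y → K (x ∙ y)
      ⁻¹-∈   : ∀ {x} → K x → K (x ⁻¹)
      conj-∈ : ∀ g {x} → K x → K (conj g x)

  InCyclic : Carrier → Carrier → Set ℓ
  InCyclic x y = ∃ λ k → y ≈ x ^ k

  cyclic-normal : ∀ {x} M → x ^ suc M ≈ ε → (∀ g → ∃ λ r → conj g x ≈ x ^ r) →
                  IsNormalSubgroup (InCyclic x)
  cyclic-normal {x} M x^[1+M]≈ε conj-x = record
    { ∈-resp = λ { y≈z (k , y≈x^k) → k , trans (sym y≈z) y≈x^k }
    ; ε-∈    = 0 , refl
    ; ∙-∈    = λ { (i , y≈x^i) (j , z≈x^j) → i + j , trans (∙-cong y≈x^i z≈x^j) (sym (^-+ x i j)) }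
    ; ⁻¹-∈   = λ { (i , y≈x^i) → M * i , trans (⁻¹-cong y≈x^i) (^-inverse M x^[1+M]≈ε i) }
    ; conj-∈ = λ { g {y} (k , y≈x^k) → let r , gx≈x^r = conj-x g in k * r , (begin
        conj g y          ≈⟨ conj-cong g y≈x^k ⟩
        conj g (x ^ k)    ≈⟨ conj-^ g x k ⟩
        conj g x ^ k      ≈⟨ ^-cong k gx≈x^r ⟩
        (x ^ r) ^ k       ≈⟨ ^-* x k r ⟨
        x ^ (k * r)       ∎) }
    }

  module _ {k : Level} {K : Carrier → Set k} (K-normal : IsNormalSubgroup K)
           {a b : Carrier} (generates : Generates G (Pair G a b)) (K[a,b] : K [ a , b ]) where
    open IsNormalSubgroup K-normal

    commutator-∈-generated : ∀ u → K [ u , a ] → K [ u , b ] → ∀ {v} → InGen G (Pair G a b) v → K [ u , v ]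
    commutator-∈-generated u ua ub (gen (inj₁ v≈a)) = ∈-resp (commutator-congʳ u (sym v≈a)) ua
    commutator-∈-generated u ua ub (gen (inj₂ v≈b)) = ∈-resp (commutator-congʳ u (sym v≈b)) ub
    commutator-∈-generated u ua ub unit = ∈-resp (sym (commutator-ε u)) ε-∈
    commutator-∈-generated u ua ub (mul {v} {w} v∈ w∈) =
      ∈-resp (sym (commutator-∙ʳ u v w))
             (∙-∈ (commutator-∈-generated u ua ub w∈) (conj-∈ w (commutator-∈-generated u ua ub v∈)))
    commutator-∈-generated u ua ub (inv {v} v∈) =
      ∈-resp (sym (commutator-⁻¹ʳ u v)) (conj-∈ (v ⁻¹) (⁻¹-∈ (commutator-∈-generated u ua ub v∈)))
    commutator-∈-generated u ua ub (resp v≈w v∈) =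
      ∈-resp (commutator-congʳ u v≈w) (commutator-∈-generated u ua ub v∈)

    commutator-swap-∈ : ∀ {u v} → K [ u , v ] → K [ v , u ]
    commutator-swap-∈ {u} {v} uv = ∈-resp (commutator-⁻¹ u v) (⁻¹-∈ uv)

    commutator-∈ : ∀ u v → K [ u , v ]
    commutator-∈ u v =
      commutator-∈-generated u (commutator-swap-∈ (a-row u)) (commutator-swap-∈ (b-row u)) (generates v)
      where
      a-row : ∀ w → K [ a , w ]
      a-row w = commutator-∈-generated a (∈-resp (sym (commutator-self a)) ε-∈) K[a,b] (generates w)
      b-row : ∀ w → K [ b , w ]
      b-row w =
        commutator-∈-generated b (commutator-swap-∈ K[a,b]) (∈-resp (sym (commutator-self b)) ε-∈) (generates w)

    derived-⊆ : ∀ {x} → InDerived G x → K x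
    derived-⊆ (gen (u , v , x≈[u,v])) = ∈-resp (sym x≈[u,v]) (commutator-∈ u v)
    derived-⊆ unit = ε-∈
    derived-⊆ (mul x∈G′ y∈G′) = ∙-∈ (derived-⊆ x∈G′) (derived-⊆ y∈G′)
    derived-⊆ (inv x∈G′) = ⁻¹-∈ (derived-⊆ x∈G′)
    derived-⊆ (resp x≈y x∈G′) = ∈-resp x≈y (derived-⊆ x∈G′)

module CommutatorWalk {c ℓ : Level} (G : Group c ℓ) (ab : AbelianizationKlein G)
  (a b : Group.Carrier G) (generates : Generates G (Pair G a b))
  (n₀ : ℕ) (γ-order : GroupTheory.IsOrder G (commutator G a b) (suc n₀))
  (derived⊆⟨γ⟩ : ∀ {x} → InDerived G x → GroupTheory.InCyclic G (commutator G a b) x)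
  where
  open Group G
  open GroupTheory G using (_^_; [_,_]; ^-+; ^-injective; ^-mod)
  open import Algebra.Properties.Group G using (⁻¹-involutive; ∙-cancelʳ)
  open import Relation.Binary.Reasoning.Setoid setoid

  γ : Carrier
  γ = [ a , b ]

  φ : Carrier → V₄
  φ = proj₁ ab

  φ-resp : ∀ {x y} → x ≈ y → φ x ≡ φ y
  φ-resp = proj₁ (proj₂ ab) _ _

  φ-∙ : ∀ x y → φ (x ∙ y) ≡ φ x ⊕ φ y
  φ-∙ = proj₁ (proj₂ (proj₂ ab))

  φ-surjective : ∀ w → ∃ λ x → φ x ≡ w
  φ-surjective = proj₁ (proj₂ (proj₂ (proj₂ ab)))

  ker⊆derived : ∀ x → φ x ≡ e₄ → InDerived G x
  ker⊆derived = proj₁ (proj₂ (proj₂ (proj₂ (proj₂ ab))))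

  derived⊆ker : ∀ x → InDerived G x → φ x ≡ e₄
  derived⊆ker = proj₂ (proj₂ (proj₂ (proj₂ (proj₂ ab))))

  φ-ε : φ ε ≡ e₄
  φ-ε = ≡.trans (φ-resp (sym (identityˡ ε))) (≡.trans (φ-∙ ε ε) (⊕-self (φ ε)))

  φ-⁻¹ : ∀ x → φ (x ⁻¹) ≡ φ x
  φ-⁻¹ x = ⊕≡e₄⇒≡ _ _ (≡.trans (≡.sym (φ-∙ (x ⁻¹) x)) (≡.trans (φ-resp (inverseˡ x)) φ-ε))

  A B : V₄
  A = φ a
  B = φ b

  φ-generated : ∀ {x} → InGen G (Pair G a b) x → ∃ λ r → φ x ≡ span₄ A B r
  φ-generated (gen (inj₁ x≈a)) = Fin.suc Fin.zero , φ-resp x≈a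
  φ-generated (gen (inj₂ x≈b)) = Fin.suc (Fin.suc (Fin.suc Fin.zero)) , φ-resp x≈b
  φ-generated unit = Fin.zero , φ-ε
  φ-generated (mul {x} {y} x∈ y∈) =
    let r , φx≡ = φ-generated x∈
        s , φy≡ = φ-generated y∈
        t , r⊕s≡t = span₄-closed A B r s
    in t , ≡.trans (φ-∙ x y) (≡.trans (cong₂ _⊕_ φx≡ φy≡) r⊕s≡t)
  φ-generated (inv {x} x∈) = let r , φx≡ = φ-generated x∈ in r , ≡.trans (φ-⁻¹ x) φx≡
  φ-generated (resp x≈y x∈) = let r , φx≡ = φ-generated x∈ in r , ≡.trans (≡.sym (φ-resp x≈y)) φx≡

  span₄-surjective : ∀ w → ∃ λ r → span₄ A B r ≡ w
  span₄-surjective w =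
    let x , φx≡w = φ-surjective w
        r , φx≡r = φ-generated (generates x)
    in r , ≡.trans (≡.sym φx≡r) φx≡w

  span₄-injective : ∀ r s → span₄ A B r ≡ span₄ A B s → r ≡ s
  span₄-injective = span₄-surjective⇒injective A B span₄-surjective

  letter : ℕ → Carrier
  letter 0 = a ⁻¹
  letter 1 = b ⁻¹
  letter 2 = a
  letter 3 = b
  letter (suc (suc (suc (suc k)))) = letter k

  letter-∈ : ∀ k → Pair G a b (letter k) ⊎ Pair G a b (letter k ⁻¹)
  letter-∈ 0 = inj₂ (inj₁ (⁻¹-involutive a))
  letter-∈ 1 = inj₂ (inj₂ (⁻¹-involutive b))
  letter-∈ 2 = inj₁ (inj₁ refl)
  letter-∈ 3 = inj₁ (inj₂ refl)
  letter-∈ (suc (suc (suc (suc k)))) = letter-∈ k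

  walk : ℕ → Carrier
  walk 0 = ε
  walk 1 = a ⁻¹
  walk 2 = a ⁻¹ ∙ b ⁻¹
  walk 3 = (a ⁻¹ ∙ b ⁻¹) ∙ a
  walk (suc (suc (suc (suc k)))) = γ ∙ walk k

  walk-step : ∀ k → walk (suc k) ≈ walk k ∙ letter k
  walk-step 0 = sym (identityˡ _)
  walk-step 1 = refl
  walk-step 2 = refl
  walk-step 3 = identityʳ γ
  walk-step (suc (suc (suc (suc k)))) = trans (∙-congˡ (walk-step k)) (sym (assoc _ _ _))

  walk-lap : ∀ q k → walk (q * 4 + k) ≈ γ ^ q ∙ walk k
  walk-lap zero k = sym (identityˡ _)
  walk-lap (suc q) k = trans (∙-congˡ (walk-lap q k)) (sym (assoc _ _ _))

  prefix : Fin 4 → Carrier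
  prefix r = walk (toℕ r)

  φ-prefix : ∀ r → φ (prefix r) ≡ span₄ A B r
  φ-prefix Fin.zero = φ-ε
  φ-prefix (Fin.suc Fin.zero) = φ-⁻¹ a
  φ-prefix (Fin.suc (Fin.suc Fin.zero)) = ≡.trans (φ-∙ _ _) (cong₂ _⊕_ (φ-⁻¹ a) (φ-⁻¹ b))
  φ-prefix (Fin.suc (Fin.suc (Fin.suc Fin.zero))) =
    ≡.trans (φ-∙ _ _) (≡.trans (cong (_⊕ A) (φ-prefix (Fin.suc (Fin.suc Fin.zero)))) ([u⊕v]⊕u≡v A B))

  φ-lap : ∀ q r → φ (γ ^ q ∙ prefix r) ≡ span₄ A B r
  φ-lap q r = ≡.trans (φ-∙ _ _) (cong₂ _⊕_ (derived⊆ker _ (γ^q∈G′ q)) (φ-prefix r))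
    where
    γ^q∈G′ : ∀ q → InDerived G (γ ^ q)
    γ^q∈G′ zero = unit
    γ^q∈G′ (suc q) = mul (gen (a , b , refl)) (γ^q∈G′ q)

  lap-injective : ∀ {q q′ r r′} → q < suc n₀ → q′ < suc n₀ →
                  γ ^ q ∙ prefix r ≈ γ ^ q′ ∙ prefix r′ → q ≡ q′ × r ≡ r′
  lap-injective {q} {q′} {r} {r′} q<n q′<n eq
    with span₄-injective r r′ (≡.trans (≡.sym (φ-lap q r)) (≡.trans (φ-resp eq) (φ-lap q′ r′)))
  ... | ≡.refl = ^-injective γ-order q<n q′<n (∙-cancelʳ (prefix r) _ _ eq) , ≡.refl

  -- Written so that Fin (suc m) is Fin (suc n₀ * 4) by definition.
  m : ℕ
  m = 3 + n₀ * 4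

  vertex : Fin (suc m) → Carrier
  vertex i = walk (toℕ i)

  lap-of : (i : Fin (suc m)) → ∃₂ λ q (r : Fin 4) → q < suc n₀ × toℕ i ≡ q * 4 + toℕ r
  lap-of i with toℕ i divMod 4
  ... | result q r i≡r+q*4 =
    let i≡q*4+r = ≡.trans i≡r+q*4 (+-comm (toℕ r) (q * 4))
        q*4<[1+n₀]*4 = ≤-<-trans (m≤m+n (q * 4) (toℕ r)) (subst (_< suc m) i≡q*4+r (toℕ<n i))
    in q , r , *-cancelʳ-< 4 q (suc n₀) q*4<[1+n₀]*4 , i≡q*4+r

  lap-index< : ∀ {q} → q < suc n₀ → (r : Fin 4) → q * 4 + toℕ r < suc m
  lap-index< {q} q<n r =
    ≤-trans (+-monoʳ-< (q * 4) (toℕ<n r)) (≤-trans (≤-reflexive (+-comm (q * 4) 4)) (*-monoˡ-≤ 4 q<n))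

  vertex-injective : ∀ i j → vertex i ≈ vertex j → i ≡ j
  vertex-injective i j vi≈vj with lap-of i | lap-of j
  ... | q , r , q<n , i≡ | q′ , r′ , q′<n , j≡ with lap-injective {r = r} {r′} q<n q′<n (begin
        γ ^ q ∙ prefix r       ≈⟨ walk-lap q (toℕ r) ⟨
        walk (q * 4 + toℕ r)   ≡⟨ cong walk i≡ ⟨
        vertex i               ≈⟨ vi≈vj ⟩
        vertex j               ≡⟨ cong walk j≡ ⟩
        walk (q′ * 4 + toℕ r′) ≈⟨ walk-lap q′ (toℕ r′) ⟩
        γ ^ q′ ∙ prefix r′     ∎)
  ... | ≡.refl , ≡.refl = toℕ-injective (≡.trans i≡ (≡.sym j≡))

  coset-representative : ∀ g → ∃ λ r → InDerived G (g ∙ prefix r ⁻¹)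
  coset-representative g =
    let r , span≡φg = span₄-surjective (φ g)
        φ[prefix⁻¹]≡φg = ≡.trans (φ-⁻¹ (prefix r)) (≡.trans (φ-prefix r) span≡φg)
    in r , ker⊆derived _ (≡.trans (φ-∙ _ _) (≡.trans (cong (φ g ⊕_) φ[prefix⁻¹]≡φg) (⊕-self (φ g))))

  vertex-surjective : ∀ g → ∃ λ i → vertex i ≈ g
  vertex-surjective g =
    let r , g/prefix∈G′ = coset-representative g
        k , g/prefix≈γ^k = derived⊆⟨γ⟩ g/prefix∈G′
        q = k % suc n₀
        i< = lap-index< (m%n<n k (suc n₀)) r
    in fromℕ< i< , (begin
      vertex (fromℕ< i<)              ≡⟨ cong walk (toℕ-fromℕ< i<) ⟩
      walk (q * 4 + toℕ r)            ≈⟨ walk-lap q (toℕ r) ⟩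
      γ ^ q ∙ prefix r                ≈⟨ ∙-congʳ (^-mod (proj₁ (proj₂ γ-order)) k) ⟨
      γ ^ k ∙ prefix r                ≈⟨ ∙-congʳ g/prefix≈γ^k ⟨
      (g ∙ prefix r ⁻¹) ∙ prefix r    ≈⟨ assoc _ _ _ ⟩
      g ∙ (prefix r ⁻¹ ∙ prefix r)    ≈⟨ ∙-congˡ (inverseˡ _) ⟩
      g ∙ ε                           ≈⟨ identityʳ g ⟩
      g                               ∎)

  edge : ∀ (i : Fin m) → CayAdj G (Pair G a b) (vertex (inject₁ i)) (vertex (Fin.suc i))
  edge i = letter (toℕ i) , letter-∈ (toℕ i) , (begin
    walk (suc (toℕ i))                     ≈⟨ walk-step (toℕ i) ⟩
    walk (toℕ i) ∙ letter (toℕ i)          ≡⟨ cong (λ t → walk t ∙ letter (toℕ i)) (toℕ-inject₁ i) ⟨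
    vertex (inject₁ i) ∙ letter (toℕ i)    ∎)

  closing-edge : CayAdj G (Pair G a b) (vertex (fromℕ m)) (vertex Fin.zero)
  closing-edge = b , inj₁ (inj₂ refl) , sym (begin
    vertex (fromℕ m) ∙ b         ≡⟨ cong (λ t → walk t ∙ b) (≡.trans (toℕ-fromℕ m) (+-comm 3 (n₀ * 4))) ⟩
    walk (n₀ * 4 + 3) ∙ b        ≈⟨ ∙-congʳ (walk-lap n₀ 3) ⟩
    (γ ^ n₀ ∙ walk 3) ∙ b        ≈⟨ assoc _ _ _ ⟩
    γ ^ n₀ ∙ γ                   ≈⟨ ∙-congˡ (identityʳ γ) ⟨
    γ ^ n₀ ∙ γ ^ 1               ≈⟨ ^-+ γ n₀ 1 ⟨
    γ ^ (n₀ + 1)                 ≡⟨ cong (γ ^_) (+-comm n₀ 1) ⟩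
    γ ^ suc n₀                   ≈⟨ proj₁ (proj₂ γ-order) ⟩
    ε                            ∎)

  hamiltonian : CayHamiltonian G (Pair G a b)
  hamiltonian = m , vertex , s≤s (s≤s z≤n) , vertex-injective , vertex-surjective , edge , closing-edge

corollary2p14 : {c ℓ : Level} (G : Group c ℓ) →
    IsFinite G → DerivedCyclic G → AbelianizationKlein G →
    (a b : Group.Carrier G) → ¬ (Group._≈_ G a b) →
    Generates G (Pair G a b) →
    CayHamiltonian G (Pair G a b)
corollary2p14 G finite cyclic ab a b _ generates =
  let open Group G
      open GroupTheory G
      γ = commutator G a b
      torsion = finite⇒torsion finite
      M , γ^[1+M]≈ε = torsion γ
      n₀ , γ-order = order-exists (finite⇒decidable finite) M γ^[1+M]≈ε
      ⟨γ⟩-normal = cyclic-normal M γ^[1+M]≈ε (derived-conj-power torsion cyclic (gen (a , b , refl)))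
      derived⊆⟨γ⟩ = derived-⊆ ⟨γ⟩-normal generates (1 , sym (identityʳ γ))
  in CommutatorWalk.hamiltonian G ab a b generates n₀ γ-order derived⊆⟨γ⟩
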